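{- Let $d<n$ be integers, let $V\subseteq\{0,1\}^n$, $P=\operatorname{conv}(V)$, let $\pi:\mathbb{R}^n\to\mathbb{R}^d$ be the projection onto the first $d$ coordinates, and let $R=\operatorname{conv}(\pi(V))$ (whose vertex set is $\pi(V)$). For $x\in\{0,1\}^d$ let $P_x=\pi^{ -1}(\{x\})\cap V$. Let $A\subseteq V$, $A^{\mathsf c}=V\setminus A$, $B=\pi(A)$, $B^{\mathsf c}=\pi(V)\setminus B$, and $M=\{x\in\{0,1\}^d : P_x\cap A\neq\emptyset \text{ and } P_x\cap A^{\mathsf c}\neq\emptyset\}$. Then \[ e_{G_P}(A,A^{\mathsf c})\geq \max\{|M|,\ e_{G_R}(B,B^{\mathsf c})\}. \]
   Context: The graph $G_Q$ of a polytope $Q$ has as vertices the $0$-dimensional faces of $Q$ and as edges the $1$-dimensional faces of $Q$; vertex sets of polytopes are identified with the polytopes. For a graph $G$, $e_G(S,T)$ is the number of edges of $G$ with one endpoint in $S$ and the other in $T$. -}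

module Defs where

open import Data.Bool using (Bool; true; false; T; not; _∧_)
open import Data.Nat using (ℕ; _≤_)
open import Data.Integer using (ℤ; _<_; _+_) renaming (0ℤ to z0)
open import Data.Fin using (Fin; inject≤)
open import Data.Vec using (Vec; []; _∷_; tabulate; lookup)
open import Data.List using (List; length)
open import Data.List.Relation.Unary.All using (All)
open import Data.List.Relation.Unary.Unique.Propositional using (Unique)
open import Data.Product using (Σ; ∃; _×_; proj₁; proj₂)
open import Relation.Binary.PropositionalEquality using (_≡_; _≢_)

Cube : ℕ → Set
Cube n = Vec Bool n

CubeSet : ℕ → Set
CubeSet n = Cube n → Bool

proj : ∀ {d n} → d ≤ n → Cube n → Cube d
proj d≤n x = tabulate (λ i → lookup x (inject≤ i d≤n))

dot : ∀ {n} → Vec ℤ n → Cube n → ℤ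
dot [] [] = z0
dot (c ∷ cs) (true ∷ xs) = c + dot cs xs
dot (c ∷ cs) (false ∷ xs) = dot cs xs

-- Edge of the graph of conv(S), for S ⊆ {0,1}^n (every point of S is a vertex
-- of conv(S)).  {u,v} is an edge iff conv{u,v} is a face, i.e. some linear
-- functional c is maximized over S exactly at u and v.
IsEdge : ∀ {n} → (Cube n → Set) → Cube n → Cube n → Set
IsEdge {n} S u v =
  S u × S v × u ≢ v ×
  Σ (Vec ℤ n) λ c → dot c u ≡ dot c v ×
    (∀ w → S w → w ≢ u → w ≢ v → dot c w < dot c u)

AtLeast : {X : Set} → (X → Set) → ℕ → Set
AtLeast {X} P k = Σ (List X) λ xs → length xs ≡ k × Unique xs × All P xs

-- Ordered pairs (s,t) with s ∈ S, t ∈ T and {s,t} an edge of G_conv(W).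
-- For disjoint S, T these are in bijection with the edges counted by e_G(S,T).
CrossEdge : ∀ {n} → (W S T : Cube n → Set) → Cube n × Cube n → Set
CrossEdge W S T p = S (proj₁ p) × T (proj₂ p) × IsEdge W (proj₁ p) (proj₂ p)

{-# OPTIONS --safe #-}

-- An edge {u, v} of conv S (S ⊆ {0,1}ⁿ) is certified by an affine function maximised over S
-- exactly at u and v, and the Hamming distance dist(·, a) to a fixed point a is affine.
-- A closest pair a ∈ A, b ∈ Aᶜ inside a mixed fibre P_y is an edge, certified by
-- −(dist(πw, y) + dist(w, a) + dist(w, b)).  An edge {y, z} of G_R with y ∈ B, z ∈ Bᶜ lifts
-- to an edge {a, b}, where a ∈ A lies over y and b is the point of V over z closest to a:
-- take the functional of {y, z} pulled back along π and break ties by a weighted sum of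
-- Hamming distances.  Both constructions are injective, since π recovers y, resp. (y, z).
module Submission where

open import Defs
open import Data.Bool using (Bool; true; false; T; not; _∧_; _xor_; if_then_else_)
import Data.Bool as Bool
open import Data.Bool.Properties using (xor-same; xor-comm)
open import Data.Nat using (ℕ; zero; suc; _+_; _*_; _≤_; _<_; _>_; z≤n; s≤s; z<s; >-nonZero)
open import Data.Nat.Properties
  using (<⇒≤; n<1+n; m≤m+n; m≤m*n; +-identityʳ; *-zeroʳ; *-monoʳ-≤; *-monoʳ-<;
         +-monoˡ-<; +-mono-≤-<; +-mono-<-≤; module ≤-Reasoning)
open import Data.Nat.Tactic.RingSolver as ℕ-Solver using ()
open import Data.Integer as ℤ using (ℤ; +_; -_; 0ℤ; -1ℤ)
import Data.Integer.Properties as ℤ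
open import Algebra.Properties.CommutativeSemigroup ℤ.+-commutativeSemigroup
  using () renaming (interchange to +-interchange)
open import Data.Integer.Tactic.RingSolver as ℤ-Solver using ()
open import Data.Vec using (Vec; []; _∷_; zipWith; map; replicate; padRight)
import Data.Vec.Properties as Vec
open import Data.List as List
  using (List; []; _∷_; [_]; filter; cartesianProductWith; cartesianProduct; length)
import Data.List.Properties as List
open import Data.List.Extrema.Nat using (argmin; argmin-all; f[argmin]≤f[xs])
open import Data.List.Membership.Propositional using (_∈_)
open import Data.List.Membership.Propositional.Properties
  using (∈-cartesianProductWith⁺; ∈-cartesianProduct⁺; ∈-filter⁺)
open import Data.List.Relation.Unary.Any using (here; there)
open import Data.List.Relation.Unary.All as All using (All; []; _∷_)
open import Data.List.Relation.Unary.All.Properties using (all-filter)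
open import Data.List.Relation.Unary.Unique.Propositional using (Unique)
import Data.List.Relation.Unary.Unique.Propositional.Properties as Unique
open import Data.Product using (Σ; ∃; _×_; _,_; proj₁; proj₂; curry; uncurry)
import Data.Product as Product
open import Data.Product.Relation.Binary.Lex.Strict using (×-Lex)
open import Data.Sum using (inj₁; inj₂)
open import Function using (_∘_; _⇔_; mk⇔; Equivalence)
open import Relation.Binary.PropositionalEquality
  using (_≡_; _≢_; refl; sym; trans; cong; cong₂; subst; subst₂; module ≡-Reasoning)
open import Relation.Nullary using (¬_; Dec; yes; no; contradiction)
open import Relation.Nullary.Decidable using (T?; _×-dec_)
open import Relation.Unary using (Decidable)

T-∧-not : ∀ {x y} → T (x ∧ not y) ⇔ (T x × ¬ T y)
T-∧-not {true}  {true}  = mk⇔ (λ ()) (λ (_ , ¬y) → ¬y _)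
T-∧-not {true}  {false} = mk⇔ (λ _ → _ , λ ()) (λ _ → _)
T-∧-not {false} {_}     = mk⇔ (λ ()) proj₁

_≟_ : ∀ {n} → (u v : Cube n) → Dec (u ≡ v)
_≟_ = Vec.≡-dec Bool._≟_

cubes : ∀ n → List (Cube n)
cubes zero    = [ [] ]
cubes (suc n) = cartesianProductWith _∷_ (true ∷ false ∷ []) (cubes n)

∈-cubes : ∀ {n} (x : Cube n) → x ∈ cubes n
∈-cubes []      = here refl
∈-cubes (b ∷ x) = ∈-cartesianProductWith⁺ _∷_ (∈-bits b) (∈-cubes x)
  where
  ∈-bits : ∀ b → b ∈ true ∷ false ∷ []
  ∈-bits true  = here refl
  ∈-bits false = there (here refl)

minimiser : ∀ {X : Set} {P : X → Set} → Decidable P → (f : X → ℕ) (xs : List X) →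
            (∀ x → x ∈ xs) → ∀ {x₀} → P x₀ → Σ X λ m → P m × (∀ x → P x → f m ≤ f x)
minimiser P? f xs complete {x₀} Px₀ =
  m , argmin-all f Px₀ (all-filter P? xs) ,
  λ x Px → All.lookup (f[argmin]≤f[xs] x₀ (filter P? xs)) (∈-filter⁺ P? (complete x) Px)
  where m = argmin f x₀ (filter P? xs)

AtLeast-lift : ∀ {X Y : Set} {P : X → Set} {Q : Y → Set} (r : Y → X) →
               (∀ x → P x → ∃ λ y → Q y × r y ≡ x) → ∀ k → AtLeast P k → AtLeast Q k
AtLeast-lift {X} {Y} {P} {Q} r lift k (xs , |xs|≡k , xs! , Pxs) =
  let ys , r[ys]≡xs , Qys = liftAll xs Pxs
  in ys , trans (sym (List.length-map r ys)) (trans (cong length r[ys]≡xs) |xs|≡k) ,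
     Unique.map⁻ (subst Unique (sym r[ys]≡xs) xs!) , Qys
  where
  liftAll : (xs : List X) → All P xs → Σ (List Y) λ ys → List.map r ys ≡ xs × All Q ys
  liftAll []       []         = [] , refl , []
  liftAll (x ∷ xs) (Px ∷ Pxs) =
    let y , Qy , ry≡x = lift x Px
        ys , r[ys]≡xs , Qys = liftAll xs Pxs
    in y ∷ ys , cong₂ _∷_ ry≡x r[ys]≡xs , Qy ∷ Qys

dot-zipWith-+ : ∀ {n} (c c′ : Vec ℤ n) w → dot (zipWith ℤ._+_ c c′) w ≡ dot c w ℤ.+ dot c′ w
dot-zipWith-+ []      []        []          = refl
dot-zipWith-+ (x ∷ c) (x′ ∷ c′) (true ∷ w)  =
  trans (cong (ℤ._+_ (x ℤ.+ x′)) (dot-zipWith-+ c c′ w)) (+-interchange x x′ (dot c w) (dot c′ w))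
dot-zipWith-+ (x ∷ c) (x′ ∷ c′) (false ∷ w) = dot-zipWith-+ c c′ w

dot-map-* : ∀ {n} s (c : Vec ℤ n) w → dot (map (s ℤ.*_) c) w ≡ s ℤ.* dot c w
dot-map-* s []      []          = sym (ℤ.*-zeroʳ s)
dot-map-* s (x ∷ c) (true ∷ w)  =
  trans (cong (ℤ._+_ (s ℤ.* x)) (dot-map-* s c w)) (sym (ℤ.*-distribˡ-+ s x (dot c w)))
dot-map-* s (x ∷ c) (false ∷ w) = dot-map-* s c w

dot-replicate-0 : ∀ {n} (w : Cube n) → dot (replicate n 0ℤ) w ≡ 0ℤ
dot-replicate-0 []          = refl
dot-replicate-0 (true ∷ w)  = trans (ℤ.+-identityˡ _) (dot-replicate-0 w)
dot-replicate-0 (false ∷ w) = dot-replicate-0 w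

dot-proj : ∀ {d n} (d≤n : d ≤ n) (c : Vec ℤ d) w → dot c (proj d≤n w) ≡ dot (padRight d≤n 0ℤ c) w
dot-proj z≤n       []      w           = sym (dot-replicate-0 w)
dot-proj (s≤s d≤n) (x ∷ c) (true ∷ w)  = cong (ℤ._+_ x) (dot-proj d≤n c w)
dot-proj (s≤s d≤n) (x ∷ c) (false ∷ w) = dot-proj d≤n c w

Affine : ∀ {n} → (Cube n → ℤ) → Set
Affine {n} F = Σ (Vec ℤ n) λ c → Σ ℤ λ k → ∀ w → F w ≡ dot c w ℤ.+ k

Affineℕ : ∀ {n} → (Cube n → ℕ) → Set
Affineℕ F = Affine (λ w → + F w)

Affine-resp : ∀ {n} {F G : Cube n → ℤ} → (∀ w → F w ≡ G w) → Affine F → Affine G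
Affine-resp F≗G (c , k , F≡) = c , k , λ w → trans (sym (F≗G w)) (F≡ w)

Affine-dot : ∀ {n} (c : Vec ℤ n) → Affine (dot c)
Affine-dot c = c , 0ℤ , λ w → sym (ℤ.+-identityʳ (dot c w))

Affine-+ : ∀ {n} {F G : Cube n → ℤ} → Affine F → Affine G → Affine (λ w → F w ℤ.+ G w)
Affine-+ {F = F} {G} (c , k , F≡) (c′ , k′ , G≡) = zipWith ℤ._+_ c c′ , k ℤ.+ k′ , λ w → begin
  F w ℤ.+ G w                               ≡⟨ cong₂ ℤ._+_ (F≡ w) (G≡ w) ⟩
  dot c w ℤ.+ k ℤ.+ (dot c′ w ℤ.+ k′)       ≡⟨ +-interchange (dot c w) k (dot c′ w) k′ ⟩
  dot c w ℤ.+ dot c′ w ℤ.+ (k ℤ.+ k′)       ≡⟨ cong (ℤ._+ (k ℤ.+ k′)) (dot-zipWith-+ c c′ w) ⟨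
  dot (zipWith ℤ._+_ c c′) w ℤ.+ (k ℤ.+ k′) ∎
  where open ≡-Reasoning

Affine-scale : ∀ {n} {F : Cube n → ℤ} s → Affine F → Affine (λ w → s ℤ.* F w)
Affine-scale {F = F} s (c , k , F≡) = map (s ℤ.*_) c , s ℤ.* k , λ w → begin
  s ℤ.* F w                          ≡⟨ cong (s ℤ.*_) (F≡ w) ⟩
  s ℤ.* (dot c w ℤ.+ k)              ≡⟨ ℤ.*-distribˡ-+ s (dot c w) k ⟩
  s ℤ.* dot c w ℤ.+ s ℤ.* k          ≡⟨ cong (ℤ._+ s ℤ.* k) (dot-map-* s c w) ⟨
  dot (map (s ℤ.*_) c) w ℤ.+ s ℤ.* k ∎
  where open ≡-Reasoning

Affine-∷ : ∀ {n} {F : Cube (suc n) → ℤ} {G : Cube n → ℤ} (g : Bool → ℤ) →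
           (∀ x w → F (x ∷ w) ≡ g x ℤ.+ G w) → Affine G → Affine F
Affine-∷ {F = F} g F≡ (c , k , G≡) = (g true ℤ.- g false) ∷ c , g false ℤ.+ k , F≡′
  where
  shift : ∀ a b x k → a ℤ.+ (x ℤ.+ k) ≡ (a ℤ.- b ℤ.+ x) ℤ.+ (b ℤ.+ k)
  shift = ℤ-Solver.solve-∀
  swap : ∀ b x k → b ℤ.+ (x ℤ.+ k) ≡ x ℤ.+ (b ℤ.+ k)
  swap = ℤ-Solver.solve-∀
  F≡′ : ∀ w → F w ≡ dot ((g true ℤ.- g false) ∷ c) w ℤ.+ (g false ℤ.+ k)
  F≡′ (true ∷ w)  = trans (F≡ true w)
    (trans (cong (ℤ._+_ (g true)) (G≡ w)) (shift (g true) (g false) (dot c w) k))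
  F≡′ (false ∷ w) = trans (F≡ false w)
    (trans (cong (ℤ._+_ (g false)) (G≡ w)) (swap (g false) (dot c w) k))

Affine-neg : ∀ {n} {F : Cube n → ℤ} → Affine F → Affine (λ w → - F w)
Affine-neg F-aff = Affine-resp (λ w → ℤ.-1*i≡-i _) (Affine-scale -1ℤ F-aff)

Affine-∘proj : ∀ {d n} (d≤n : d ≤ n) {F : Cube d → ℤ} → Affine F → Affine (F ∘ proj d≤n)
Affine-∘proj d≤n (c , k , F≡) =
  padRight d≤n 0ℤ c , k , λ w → trans (F≡ (proj d≤n w)) (cong (ℤ._+ k) (dot-proj d≤n c w))

Affineℕ-+ : ∀ {n} {F G : Cube n → ℕ} → Affineℕ F → Affineℕ G → Affineℕ (λ w → F w + G w)
Affineℕ-+ {F = F} {G} F-aff G-aff =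
  Affine-resp (λ w → sym (ℤ.pos-+ (F w) (G w))) (Affine-+ F-aff G-aff)

Affineℕ-scale : ∀ {n} {F : Cube n → ℕ} s → Affineℕ F → Affineℕ (λ w → s * F w)
Affineℕ-scale {F = F} s F-aff =
  Affine-resp (λ w → sym (ℤ.pos-* s (F w))) (Affine-scale (+ s) F-aff)

hamming : ∀ {n} → Cube n → Cube n → ℕ
hamming []      []      = 0
hamming (x ∷ u) (y ∷ v) = (if x xor y then 1 else 0) + hamming u v

hamming-self : ∀ {n} (u : Cube n) → hamming u u ≡ 0
hamming-self []      = refl
hamming-self (x ∷ u) rewrite xor-same x = hamming-self u

hamming-sym : ∀ {n} (u v : Cube n) → hamming u v ≡ hamming v u
hamming-sym []      []      = refl
hamming-sym (x ∷ u) (y ∷ v) rewrite xor-comm x y = cong₂ _+_ refl (hamming-sym u v)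

hamming-pos : ∀ {n} (u v : Cube n) → u ≢ v → 0 < hamming u v
hamming-pos []          []          []≢[] = contradiction refl []≢[]
hamming-pos (true ∷ u)  (false ∷ v) _     = z<s
hamming-pos (false ∷ u) (true ∷ v)  _     = z<s
hamming-pos (true ∷ u)  (true ∷ v)  u≢v   = hamming-pos u v (u≢v ∘ cong (true ∷_))
hamming-pos (false ∷ u) (false ∷ v) u≢v   = hamming-pos u v (u≢v ∘ cong (false ∷_))

Affine-hamming : ∀ {n} (a : Cube n) → Affineℕ (λ w → hamming w a)
Affine-hamming []      = [] , 0ℤ , λ { [] → refl }
Affine-hamming (y ∷ a) =
  Affine-∷ (λ x → + (if x xor y then 1 else 0)) (λ x w → ℤ.pos-+ _ (hamming w a)) (Affine-hamming a)

affineMaximum⇒IsEdge : ∀ {n} {S : Cube n → Set} {u v : Cube n} {h : Cube n → ℤ} → Affine h →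
                       S u → S v → u ≢ v → h u ≡ h v →
                       (∀ w → S w → w ≢ u → w ≢ v → h w ℤ.< h u) → IsEdge S u v
affineMaximum⇒IsEdge {u = u} {v} (c , k , h≡) Su Sv u≢v hu≡hv h-max =
  Su , Sv , u≢v , c ,
  subst₂ _≡_ (cancel (dot c u)) (cancel (dot c v))
    (cong (ℤ._- k) (trans (sym (h≡ u)) (trans hu≡hv (h≡ v)))) ,
  λ w Sw w≢u w≢v → subst₂ ℤ._<_ (cancel (dot c w)) (cancel (dot c u))
    (ℤ.+-monoˡ-< (- k) (subst₂ ℤ._<_ (h≡ w) (h≡ u) (h-max w Sw w≢u w≢v)))
  where
  cancel : ∀ x → x ℤ.+ k ℤ.- k ≡ x
  cancel x = trans (ℤ.+-assoc x k (- k)) (trans (cong (ℤ._+_ x) (ℤ.+-inverseʳ k)) (ℤ.+-identityʳ x))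

lex⇒weighted-< : ∀ {N p q : ℕ} {x y : ℤ} → p < N → ×-Lex _≡_ ℤ._<_ _>_ (x , q) (y , p) →
                 + N ℤ.* x ℤ.- + q ℤ.< + N ℤ.* y ℤ.- + p
lex⇒weighted-< {N} {p} {q} {x} {y} p<N (inj₁ x<y) = begin-strict
  + N ℤ.* x ℤ.- + q             ≤⟨ ℤ.i≤j⇒i-k≤j (+ q) ℤ.≤-refl ⟩
  + N ℤ.* x                     ≡⟨ unshift (+ N) x ⟩
  + N ℤ.* (ℤ.1ℤ ℤ.+ x) ℤ.- + N  ≤⟨ ℤ.+-monoˡ-≤ (- + N)
                                     (ℤ.*-monoˡ-≤-nonNeg (+ N) (ℤ.i<j⇒suc[i]≤j x<y)) ⟩
  + N ℤ.* y ℤ.- + N             <⟨ ℤ.+-monoʳ-< (+ N ℤ.* y) (ℤ.neg-mono-< (ℤ.+<+ p<N)) ⟩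
  + N ℤ.* y ℤ.- + p             ∎
  where
  open ℤ.≤-Reasoning
  unshift : ∀ n x → n ℤ.* x ≡ n ℤ.* (ℤ.1ℤ ℤ.+ x) ℤ.- n
  unshift = ℤ-Solver.solve-∀
lex⇒weighted-< {N} {x = x} _ (inj₂ (refl , p<q)) =
  ℤ.+-monoʳ-< (+ N ℤ.* x) (ℤ.neg-mono-< (ℤ.+<+ p<q))

-- The weight N = Q u + 1 makes ψ dominate: N ψ − Q orders S lexicographically by (ψ, −Q).
lexMaximum⇒IsEdge : ∀ {n} {S : Cube n → Set} {u v : Cube n} {ψ : Cube n → ℤ} {Q : Cube n → ℕ} →
                    Affine ψ → Affineℕ Q → S u → S v → u ≢ v → ψ u ≡ ψ v → Q u ≡ Q v →
                    (∀ w → S w → w ≢ u → w ≢ v → ×-Lex _≡_ ℤ._<_ _>_ (ψ w , Q w) (ψ u , Q u)) →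
                    IsEdge S u v
lexMaximum⇒IsEdge {u = u} {ψ = ψ} {Q} ψ-aff Q-aff Su Sv u≢v ψu≡ψv Qu≡Qv lex-max =
  affineMaximum⇒IsEdge (Affine-+ (Affine-scale (+ N) ψ-aff) (Affine-neg Q-aff)) Su Sv u≢v
    (cong₂ (λ x q → + N ℤ.* x ℤ.- + q) ψu≡ψv Qu≡Qv)
    (λ w Sw w≢u w≢v → lex⇒weighted-< (n<1+n (Q u)) (lex-max w Sw w≢u w≢v))
  where
  N : ℕ
  N = suc (Q u)

module _ {d n} (d≤n : d ≤ n) where
  private
    π : Cube n → Cube d
    π = proj d≤n

  closestLift⇒IsEdge : ∀ {S : Cube n → Set} {y z : Cube d} {a b : Cube n} →
                       IsEdge (λ y → ∃ λ x → S x × π x ≡ y) y z →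
                       S a → π a ≡ y → S b → π b ≡ z →
                       (∀ w → S w → π w ≡ z → hamming b a ≤ hamming w a) → IsEdge S a b
  closestLift⇒IsEdge {S} {y} {z} {a} {b} (_ , _ , y≢z , c , cy≡cz , c-max) Sa πa≡y Sb πb≡z closest =
    lexMaximum⇒IsEdge {ψ = dot c ∘ π} {Q} (Affine-∘proj d≤n (Affine-dot c)) Q-affine
      Sa Sb a≢b ψa≡ψb Qa≡Qb lex-max
    where
    -- Q a = Q b = e δ (δ + 1).  Over y, any w ≠ a pays at least e (δ + 1) for its distance
    -- to a; over z, any w ≠ b is at least as far from a as b is, and strictly farther from b.
    e δ : ℕ
    e = hamming y z
    δ = hamming a b

    X Q : Cube n → ℕ
    X w = suc δ * hamming w a + hamming w b
    Q w = e * X w + δ * δ * hamming (π w) z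

    Q-affine : Affineℕ Q
    Q-affine =
      Affineℕ-+
        (Affineℕ-scale e (Affineℕ-+ (Affineℕ-scale (suc δ) (Affine-hamming a)) (Affine-hamming b)))
        (Affineℕ-scale (δ * δ) (Affine-∘proj d≤n (Affine-hamming z)))

    a≢b : a ≢ b
    a≢b a≡b = y≢z (trans (sym πa≡y) (trans (cong π a≡b) πb≡z))

    ψa≡ψb : dot c (π a) ≡ dot c (π b)
    ψa≡ψb = trans (cong (dot c) πa≡y) (trans cy≡cz (cong (dot c) (sym πb≡z)))

    X-a : X a ≡ δ
    X-a = cong (_+ δ) (trans (cong (suc δ *_) (hamming-self a)) (*-zeroʳ (suc δ)))

    X-b : X b ≡ suc δ * δ
    X-b = trans (cong₂ (λ p q → suc δ * p + q) (hamming-sym b a) (hamming-self b)) (+-identityʳ _)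

    Qa≡Qb : Q a ≡ Q b
    Qa≡Qb = begin
      Q a                           ≡⟨ cong₂ (λ x h → e * x + δ * δ * h) X-a
                                        (cong (λ v → hamming v z) πa≡y) ⟩
      e * δ + δ * δ * e             ≡⟨ balance e δ ⟩
      e * ((1 + δ) * δ) + δ * δ * 0 ≡⟨ cong₂ (λ x h → e * x + δ * δ * h) X-b
                                        (trans (cong (λ v → hamming v z) πb≡z) (hamming-self z)) ⟨
      Q b                           ∎
      where
      open ≡-Reasoning
      balance : ∀ e δ → e * δ + δ * δ * e ≡ e * ((1 + δ) * δ) + δ * δ * 0
      balance = ℕ-Solver.solve-∀

    Q-mono : ∀ w w′ → π w ≡ π w′ → X w < X w′ → Q w < Q w′
    Q-mono w w′ πw≡πw′ Xw<Xw′ =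
      subst (λ v → Q w < e * X w′ + δ * δ * hamming v z) πw≡πw′
        (+-monoˡ-< (δ * δ * hamming (π w) z)
          (*-monoʳ-< e {{>-nonZero (hamming-pos y z y≢z)}} Xw<Xw′))

    Xa<X : ∀ w → w ≢ a → X a < X w
    Xa<X w w≢a = begin-strict
      X a                 ≡⟨ X-a ⟩
      δ                   <⟨ n<1+n δ ⟩
      suc δ               ≤⟨ m≤m*n (suc δ) (hamming w a) {{>-nonZero (hamming-pos w a w≢a)}} ⟩
      suc δ * hamming w a ≤⟨ m≤m+n _ _ ⟩
      X w                 ∎
      where open ≤-Reasoning

    Xb<X : ∀ w → S w → π w ≡ z → w ≢ b → X b < X w
    Xb<X w Sw πw≡z w≢b =
      +-mono-≤-< (*-monoʳ-≤ (suc δ) (closest w Sw πw≡z))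
                 (subst (_< hamming w b) (sym (hamming-self b)) (hamming-pos w b w≢b))

    lex-max : ∀ w → S w → w ≢ a → w ≢ b →
              ×-Lex _≡_ ℤ._<_ _>_ (dot c (π w) , Q w) (dot c (π a) , Q a)
    lex-max w Sw w≢a w≢b with π w ≟ y | π w ≟ z
    ... | yes πw≡y | _       =
      inj₂ (cong (dot c) (trans πw≡y (sym πa≡y)) , Q-mono a w (trans πa≡y (sym πw≡y)) (Xa<X w w≢a))
    ... | no _     | yes πw≡z =
      inj₂ (trans (cong (dot c) (trans πw≡z (sym πb≡z))) (sym ψa≡ψb) ,
            subst (_< Q w) (sym Qa≡Qb) (Q-mono b w (trans πb≡z (sym πw≡z)) (Xb<X w Sw πw≡z w≢b)))
    ... | no πw≢y  | no πw≢z =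
      inj₁ (subst (dot c (π w) ℤ.<_) (cong (dot c) (sym πa≡y))
              (c-max (π w) (w , Sw , refl) πw≢y πw≢z))

module _ {d n} (d≤n : d ≤ n) (V A : CubeSet n) (A⊆V : ∀ a → T (A a) → T (V a)) where
  private
    π : Cube n → Cube d
    π = proj d≤n

    InV InA InAᶜ : Cube n → Set
    InV x  = T (V x)
    InA x  = T (A x)
    InAᶜ x = T (V x ∧ not (A x))

  SplitPair : Cube d → Cube n × Cube n → Set
  SplitPair y (a , b) = InA a × π a ≡ y × InAᶜ b × π b ≡ y

  closestSplitPair⇒IsEdge : ∀ {y a b} → SplitPair y (a , b) →
                            (∀ p → SplitPair y p → hamming a b ≤ uncurry hamming p) → IsEdge InV a b
  closestSplitPair⇒IsEdge {y} {a} {b} (a∈A , πa≡y , b∈Aᶜ , πb≡y) closest =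
    lexMaximum⇒IsEdge {ψ = ψ} {Q} (Affine-neg (Affine-∘proj d≤n (Affine-hamming y)))
      (Affineℕ-+ (Affine-hamming a) (Affine-hamming b))
      (A⊆V a a∈A) b∈V a≢b (cong ψ′ (trans πa≡y (sym πb≡y))) (trans Q-a (sym Q-b)) lex-max
    where
    ψ′ : Cube d → ℤ
    ψ′ v = - + hamming v y

    ψ : Cube n → ℤ
    ψ = ψ′ ∘ π

    δ : ℕ
    δ = hamming a b

    Q : Cube n → ℕ
    Q w = hamming w a + hamming w b

    b∈V : InV b
    b∈V = proj₁ (Equivalence.to T-∧-not b∈Aᶜ)

    a≢b : a ≢ b
    a≢b a≡b = proj₂ (Equivalence.to T-∧-not b∈Aᶜ) (subst InA a≡b a∈A)

    ψa≡0 : ψ a ≡ 0ℤ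
    ψa≡0 = trans (cong ψ′ πa≡y) (cong (λ h → - + h) (hamming-self y))

    Q-a : Q a ≡ δ
    Q-a = cong (_+ δ) (hamming-self a)

    Q-b : Q b ≡ δ
    Q-b = trans (cong₂ _+_ (hamming-sym b a) (hamming-self b)) (+-identityʳ δ)

    -- Otherwise w would form a closer split pair, (w, b) or (a, w).
    δ<Q : ∀ w → InV w → w ≢ a → w ≢ b → π w ≡ y → δ < Q w
    δ<Q w w∈V w≢a w≢b πw≡y with T? (A w)
    ... | yes w∈A = +-mono-<-≤ (hamming-pos w a w≢a) (closest (w , b) (w∈A , πw≡y , b∈Aᶜ , πb≡y))
    ... | no  w∉A = subst (_< Q w) (+-identityʳ δ) (+-mono-≤-<
      (subst (δ ≤_) (hamming-sym a w)
        (closest (a , w) (a∈A , πa≡y , Equivalence.from T-∧-not (w∈V , w∉A) , πw≡y)))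
      (hamming-pos w b w≢b))

    lex-max : ∀ w → InV w → w ≢ a → w ≢ b → ×-Lex _≡_ ℤ._<_ _>_ (ψ w , Q w) (ψ a , Q a)
    lex-max w w∈V w≢a w≢b with π w ≟ y
    ... | yes πw≡y =
      inj₂ (cong ψ′ (trans πw≡y (sym πa≡y)) , subst (_< Q w) (sym Q-a) (δ<Q w w∈V w≢a w≢b πw≡y))
    ... | no  πw≢y =
      inj₁ (subst (ψ w ℤ.<_) (sym ψa≡0) (ℤ.neg-mono-< (ℤ.+<+ (hamming-pos (π w) y πw≢y))))

  splitFibre⇒CrossEdge : ∀ y → (∃ λ a → InA a × π a ≡ y) → (∃ λ b → InAᶜ b × π b ≡ y) →
                    ∃ λ p → CrossEdge InV InA InAᶜ p × π (proj₁ p) ≡ y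
  splitFibre⇒CrossEdge y (a₀ , a₀∈A , πa₀≡y) (b₀ , b₀∈Aᶜ , πb₀≡y) =
    let (a , b) , split , closest =
          minimiser SplitPair? (uncurry hamming) (cartesianProduct (cubes n) (cubes n))
            (λ (u , v) → ∈-cartesianProduct⁺ (∈-cubes u) (∈-cubes v)) (a₀∈A , πa₀≡y , b₀∈Aᶜ , πb₀≡y)
        a∈A , πa≡y , b∈Aᶜ , _ = split
    in (a , b) , (a∈A , b∈Aᶜ , closestSplitPair⇒IsEdge split closest) , πa≡y
    where
    SplitPair? : Decidable (SplitPair y)
    SplitPair? (a , b) = T? (A a) ×-dec π a ≟ y ×-dec T? (V b ∧ not (A b)) ×-dec π b ≟ y

  imageCrossEdge⇒CrossEdge : ∀ {y z} → (∃ λ a → InA a × π a ≡ y) →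
               (∃ λ b → InV b × π b ≡ z) × ¬ (∃ λ b → InA b × π b ≡ z) →
               IsEdge (λ y → ∃ λ x → InV x × π x ≡ y) y z →
               ∃ λ p → CrossEdge InV InA InAᶜ p × Product.map π π p ≡ (y , z)
  imageCrossEdge⇒CrossEdge {z = z} (a , a∈A , πa≡y) ((b₀ , b₀∈V , πb₀≡z) , z∉πA) yz-edge =
    let b , (b∈V , πb≡z) , closest =
          minimiser InFibre? (λ w → hamming w a) (cubes n) ∈-cubes (b₀∈V , πb₀≡z)
        b∈Aᶜ = Equivalence.from T-∧-not (b∈V , λ b∈A → z∉πA (b , b∈A , πb≡z))
    in (a , b) ,
       (a∈A , b∈Aᶜ ,
        closestLift⇒IsEdge d≤n yz-edge (A⊆V a a∈A) πa≡y b∈V πb≡z (λ w → curry (closest w))) ,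
       cong₂ _,_ πa≡y πb≡z
    where
    InFibre? : Decidable (λ w → InV w × π w ≡ z)
    InFibre? w = T? (V w) ×-dec π w ≟ z

lemma2p7 : (d n : ℕ) (d<n : d < n) (V A : CubeSet n) →
  (∀ a → T (A a) → T (V a)) →
  let π = proj (<⇒≤ d<n)
      Vs = λ (x : Cube n) → T (V x)
      As = λ (x : Cube n) → T (A x)
      Acs = λ (x : Cube n) → T (V x ∧ not (A x))
      πV = λ (y : Cube d) → ∃ λ x → T (V x) × π x ≡ y
      Bs = λ (y : Cube d) → ∃ λ x → T (A x) × π x ≡ y
      Bcs = λ (y : Cube d) → πV y × ¬ Bs y
      Ms = λ (y : Cube d) → (∃ λ x → As x × π x ≡ y) × (∃ λ x → Acs x × π x ≡ y)
  in (∀ k → AtLeast Ms k → AtLeast (CrossEdge Vs As Acs) k)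
     × (∀ k → AtLeast (CrossEdge πV Bs Bcs) k → AtLeast (CrossEdge Vs As Acs) k)
lemma2p7 d n d<n V A A⊆V =
  AtLeast-lift (π ∘ proj₁)
    (λ y (y∈πA , y∈πAᶜ) → splitFibre⇒CrossEdge d≤n V A A⊆V y y∈πA y∈πAᶜ) ,
  AtLeast-lift (Product.map π π)
    (λ _ (y∈B , z∈Bᶜ , yz-edge) → imageCrossEdge⇒CrossEdge d≤n V A A⊆V y∈B z∈Bᶜ yz-edge)
  where
  d≤n : d ≤ n
  d≤n = <⇒≤ d<n

  π : Cube n → Cube d
  π = proj d≤n
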